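{- For every $\textsc{LTL}_f$-formula $\varphi$ over a finite set of propositions $\mathcal{P}$ (alphabet $\Sigma=2^{\mathcal{P}}$) there exists a diagonal SSM $\mathcal{S}_\varphi\in\mathfrak{S}_{\mathrm{diag}}$ over $\Sigma$ such that for all $w=a_1\cdots a_n\in\Sigma^*$: $w\models\varphi$ if and only if $\mathcal{S}_\varphi$ accepts the reversed word $\overleftarrow{w}=a_n\cdots a_1$.
   Context: $\textsc{LTL}_f$ formulas over $\mathcal{P}$: $\varphi::=p\mid\neg\varphi\mid\varphi\wedge\varphi\mid \mathtt{X}\varphi\mid\varphi\,\mathtt{U}\,\varphi$ with $p\in\mathcal{P}$. For $w=a_1\cdots a_n\in(2^{\mathcal{P}})^*$ and $i\in\{1,\dots,n\}$: $w,i\models p$ iff $p\in a_i$; $\neg$ and $\wedge$ as usual; $w,i\models\mathtt{X}\varphi$ iff $i<n$ and $w,i+1\models\varphi$; $w,i\models\varphi\,\mathtt{U}\,\psi$ iff there is $i\le k\le n$ with $w,k\models\psi$ and $w,j\models\varphi$ for all $i\le j<k$. $w\models\varphi$ means $w,1\models\varphi$. A feedforward neural network (FNN) is a composition of layers of nodes computing $\mathbf{x}\mapsto\mathit{relu}(\sum_i c_ix_i+b)$, $\mathit{relu}(x)=\max(0,x)$. An SSM layer of dimension $d$ is a tuple $(\mathbf{h}_0,\mathit{gate},\mathit{inc},\phi)$ with $\mathbf{h}_0\in\mathbb{R}^d$, $\mathit{gate}\colon\mathbb{R}^d\to\mathbb{R}^{d\times d}$, $\mathit{inc}\colon\mathbb{R}^d\to\mathbb{R}^d$,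 $\phi\colon\mathbb{R}^d\times\mathbb{R}^d\to\mathbb{R}^d$ (computed by an FNN); on input $\mathbf{x}_1\cdots\mathbf{x}_k$ it computes $\mathbf{h}_t=\mathit{gate}(\mathbf{x}_t)\mathbf{h}_{t-1}+\mathit{inc}(\mathbf{x}_t)$ and outputs $\mathbf{z}_t=\phi(\mathbf{h}_t,\mathbf{x}_t)$. An SSM over $\Sigma$ with $L$ layers is $(\mathit{emb},l_1,\dots,l_L,\mathit{out})$ with $\mathit{emb}\colon\Sigma\to\mathbb{R}^d$ and $\mathit{out}$ computed by an FNN; on $w=a_1\cdots a_k$ it sets $\mathbf{x}^0_i=\mathit{emb}(a_i)$, applies the layers in sequence, and outputs $\mathcal{S}(w)=\mathit{out}(\mathbf{x}^L_k)$; it accepts $w$ iff $\mathcal{S}(w)=1$. $\mathfrak{S}_{\mathrm{diag}}$ is the class of SSM in which every $\mathit{gate}(\mathbf{x})$ is a diagonal matrix. -}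

module Defs where

open import Data.Nat as ℕ using (ℕ; zero; suc; _≤_; _<_)
open import Data.Fin using (Fin; toℕ; combine) renaming (zero to fzero)
open import Data.Fin.Subset using (Subset; _∈_)
open import Data.Rational using (ℚ; 0ℚ; 1ℚ; _+_; _*_; _⊔_)
open import Data.Vec as Vec using (Vec; []; _∷_; lookup; last; reverse)
open import Data.Vec.Functional as VF using (Vector)
open import Data.List using (List; []; _∷_)
open import Data.List.Relation.Unary.All using (All)
open import Data.Product using (Σ; _×_)
open import Relation.Binary.PropositionalEquality using (_≡_; _≢_)
open import Relation.Nullary using (¬_)

Letter : ℕ → Set
Letter m = Subset m

data LTL (m : ℕ) : Set where
  prop : Fin m → LTL m
  ¬ₗ_  : LTL m → LTL m
  _∧ₗ_ : LTL m → LTL m → LTL m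
  Xₗ_  : LTL m → LTL m
  _Uₗ_ : LTL m → LTL m → LTL m

-- w , i ⊨ φ ; positions are 0-indexed Fin n (i represents paper position i+1)
_,_⊨_ : ∀ {m n} → Vec (Letter m) n → Fin n → LTL m → Set
w , i ⊨ prop p  = p ∈ lookup w i
w , i ⊨ (¬ₗ φ)  = ¬ (w , i ⊨ φ)
w , i ⊨ (φ ∧ₗ ψ) = (w , i ⊨ φ) × (w , i ⊨ ψ)
_,_⊨_ {n = n} w i (Xₗ φ) = Σ (Fin n) λ j → (toℕ j ≡ suc (toℕ i)) × (w , j ⊨ φ)
_,_⊨_ {n = n} w i (φ Uₗ ψ) =
  Σ (Fin n) λ k → (toℕ i ≤ toℕ k) × (w , k ⊨ ψ) ×
    ((j : Fin n) → toℕ i ≤ toℕ j → toℕ j < toℕ k → w , j ⊨ φ)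

_⊨_ : ∀ {m n} → Vec (Letter m) (suc n) → LTL m → Set
w ⊨ φ = w , fzero ⊨ φ

relu : ℚ → ℚ
relu x = x ⊔ 0ℚ

sumV : ∀ {n} → Vector ℚ n → ℚ
sumV = VF.foldr _+_ 0ℚ

record Layer (a b : ℕ) : Set where
  field
    weight : Fin b → Fin a → ℚ
    bias   : Fin b → ℚ

evalLayer : ∀ {a b} → Layer a b → Vector ℚ a → Vector ℚ b
evalLayer L x k = relu (sumV (λ i → Layer.weight L k i * x i) + Layer.bias L k)

data FNN (a : ℕ) : ℕ → Set where
  single : ∀ {b} → Layer a b → FNN a b
  _▷_    : ∀ {b c} → FNN a b → Layer b c → FNN a c

eval : ∀ {a b} → FNN a b → Vector ℚ a → Vector ℚ b
eval (single L) x = evalLayer L x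
eval (N ▷ L) x = evalLayer L (eval N x)

record SSMLayer (d : ℕ) : Set where
  field
    h₀   : Vector ℚ d
    gate : FNN d (d ℕ.* d)
    inc  : FNN d d
    φ    : FNN (d ℕ.+ d) d      -- φ(h , x), input is h ++ x

gateMatrix : ∀ {d} → SSMLayer d → Vector ℚ d → Fin d → Fin d → ℚ
gateMatrix l x i j = eval (SSMLayer.gate l) x (combine i j)

matVec : ∀ {d} → (Fin d → Fin d → ℚ) → Vector ℚ d → Vector ℚ d
matVec M h i = sumV (λ j → M i j * h j)

runLayer : ∀ {d n} → SSMLayer d → Vector ℚ d → Vec (Vector ℚ d) n → Vec (Vector ℚ d) n
runLayer l h [] = []
runLayer l h (x ∷ xs) = z ∷ runLayer l h′ xs
  where
    h′ : Vector ℚ _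
    h′ i = matVec (gateMatrix l x) h i + eval (SSMLayer.inc l) x i
    z = eval (SSMLayer.φ l) (h′ VF.++ x)

runLayers : ∀ {d n} → List (SSMLayer d) → Vec (Vector ℚ d) n → Vec (Vector ℚ d) n
runLayers [] xs = xs
runLayers (l ∷ ls) xs = runLayers ls (runLayer l (SSMLayer.h₀ l) xs)

record SSM (m : ℕ) : Set where
  field
    d      : ℕ
    emb    : Letter m → Vector ℚ d
    layers : List (SSMLayer d)
    out    : FNN d 1

runSSM : ∀ {m n} → (S : SSM m) → Vec (Letter m) (suc n) → ℚ
runSSM S w = eval (SSM.out S) (last (runLayers (SSM.layers S) (Vec.map (SSM.emb S) w))) fzero

Accepts : ∀ {m n} → SSM m → Vec (Letter m) (suc n) → Set
Accepts S w = runSSM S w ≡ 1ℚ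

IsDiagLayer : ∀ {d} → SSMLayer d → Set
IsDiagLayer {d} l = (x : Vector ℚ d) (i j : Fin d) → i ≢ j → gateMatrix l x i j ≡ 0ℚ

IsDiag : ∀ {m} → SSM m → Set
IsDiag S = All IsDiagLayer (SSM.layers S)

-- Feed the SSM the reversed word, so that after reading a_n … a_i it has seen exactly the
-- suffix a_i … a_n, and evaluate φ bottom-up on suffixes.  Every subformula occurrence owns a
-- coordinate of the residual stream, and one diagonal layer per occurrence writes the 0/1
-- truth value of that subformula on the current suffix into its coordinate, copying all the
-- others.  Atoms come from the embedding, ¬ and ∧ are ReLU gates on the current vector, and
-- U is the recurrence h = [ψ] + [φ]·h, whose gate relu([φ] − [ψ]) depends only on the input.
-- X needs the truth value at the previous step: its layer keeps the whole history of its
-- argument q in the ternary expansion h′ = h/3 + 2q, and recovers the previous bit as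
-- whether 3(h′ − 2q) = h is at least 2.
module Submission where

open import Defs
open import Data.Nat using (ℕ; suc)
open import Data.Vec using (Vec; reverse)
open import Data.Product using (Σ; _×_)
open import Function.Bundles using (_⇔_)

open import Algebra.Bundles using (CommutativeMonoid; CommutativeRing)
open import Data.Empty using (⊥; ⊥-elim)
open import Data.Fin as Fin using (Fin; _↑ˡ_; _↑ʳ_; splitAt; combine; toℕ)
  renaming (zero to fzero; suc to fsuc)
open import Data.Fin.Properties
  using (suc-injective; punchInᵢ≢i; combine-injective; splitAt-↑ˡ; splitAt-↑ʳ; ↑ˡ-injective;
         ↑ʳ-injective)
open import Data.Fin.Subset using (_∈_)
open import Data.Fin.Subset.Properties using (_∈?_)
import Data.Integer as ℤ
open import Data.List as List using (List; []; _∷_; _++_; _ʳ++_)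
open import Data.List.Properties using (reverse-involutive)
open import Data.List.Relation.Unary.All using (All; []; _∷_)
open import Data.List.Relation.Unary.All.Properties using (++⁺)
open import Data.Nat as ℕ using (z≤n; s≤s)
open import Data.Nat.Properties as ℕ using ()
open import Data.Product using (proj₁; proj₂) renaming (_,_ to _&_)
open import Data.Product.Function.NonDependent.Propositional using (_×-⇔_)
open import Data.Rational as ℚ using (ℚ; 0ℚ; 1ℚ; _+_; _*_; -_; _≤_; _/_)
import Data.Rational.Properties as ℚ
open import Data.Rational.Solver using (module +-*-Solver)
open import Data.Sum using (_⊎_; inj₁; inj₂; [_,_])
open import Data.Sum.Function.Propositional using (_⊎-⇔_)
open import Data.Unit using (tt)
open import Data.Vec as Vec using ([]; _∷_; _∷ʳ_; toList; last)
open import Data.Vec.Properties using (reverse-∷; last-∷ʳ; toList-reverse)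
open import Data.Vec.Functional as VF using (Vector; updateAt; removeAt)
open import Data.Vec.Functional.Properties
  using (updateAt-updates; updateAt-minimal; lookup-++ˡ; lookup-++ʳ)
open import Function using (_∘_)
open import Function.Bundles using (mk⇔; Equivalence)
open import Function.Definitions using (Injective)
open import Function.Properties.Equivalence using () renaming (refl to ⇔-refl; trans to ⇔-trans)
open import Function.Related.TypeIsomorphisms using (¬-cong-⇔)
open import Relation.Nullary using (¬_; Dec; yes; no)
open import Relation.Binary.PropositionalEquality
  using (_≡_; _≢_; refl; sym; trans; cong; cong₂; subst; ≢-sym; module ≡-Reasoning)

open import Algebra.Properties.Semiring.Sum (CommutativeRing.semiring ℚ.+-*-commutativeRing)
  using (sum-remove; sum-cong-≗; sum-replicate-zero; ∑-distrib-+; *-distribˡ-sum)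
open import Algebra.Properties.CommutativeSemigroup
  (CommutativeMonoid.commutativeSemigroup ℚ.+-0-commutativeMonoid) using (interchange)
open +-*-Solver using (solve; _:+_; _:*_; _:=_) renaming (con to lit)
open ≡-Reasoning

private
  variable
    m d k n : ℕ

Sat : LTL m → List (Letter m) → Set
Sat φ [] = ⊥
Sat (prop p) (a ∷ u) = p ∈ a
Sat (¬ₗ φ) (a ∷ u) = ¬ Sat φ (a ∷ u)
Sat (φ ∧ₗ ψ) (a ∷ u) = Sat φ (a ∷ u) × Sat ψ (a ∷ u)
Sat (Xₗ φ) (a ∷ u) = Sat φ u
Sat (φ Uₗ ψ) (a ∷ u) = Sat ψ (a ∷ u) ⊎ (Sat φ (a ∷ u) × Sat (φ Uₗ ψ) u)

⊨-suc : ∀ φ a (w : Vec (Letter m) k) i → ((a ∷ w) , fsuc i ⊨ φ) ⇔ (w , i ⊨ φ)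
⊨-suc (prop p) a w i = ⇔-refl
⊨-suc (¬ₗ φ) a w i = ¬-cong-⇔ (⊨-suc φ a w i)
⊨-suc (φ ∧ₗ ψ) a w i = ⊨-suc φ a w i ×-⇔ ⊨-suc ψ a w i
⊨-suc (Xₗ φ) a w i = mk⇔ to from
  where
  to : (a ∷ w) , fsuc i ⊨ (Xₗ φ) → w , i ⊨ (Xₗ φ)
  to (fsuc j & j≡ & s) = j & ℕ.suc-injective j≡ & Equivalence.to (⊨-suc φ a w j) s
  from : w , i ⊨ (Xₗ φ) → (a ∷ w) , fsuc i ⊨ (Xₗ φ)
  from (j & j≡ & s) = fsuc j & cong suc j≡ & Equivalence.from (⊨-suc φ a w j) s
⊨-suc (φ Uₗ ψ) a w i = mk⇔ to from
  where
  to : (a ∷ w) , fsuc i ⊨ (φ Uₗ ψ) → w , i ⊨ (φ Uₗ ψ)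
  to (fsuc k & s≤s i≤k & s & before) =
    k & i≤k & Equivalence.to (⊨-suc ψ a w k) s &
    λ j i≤j j<k → Equivalence.to (⊨-suc φ a w j) (before (fsuc j) (s≤s i≤j) (s≤s j<k))
  from : w , i ⊨ (φ Uₗ ψ) → (a ∷ w) , fsuc i ⊨ (φ Uₗ ψ)
  from (k & i≤k & s & before) = fsuc k & s≤s i≤k & Equivalence.from (⊨-suc ψ a w k) s & before′
    where
    before′ : ∀ j → suc (toℕ i) ℕ.≤ toℕ j → toℕ j ℕ.< suc (toℕ k) → (a ∷ w) , j ⊨ φ
    before′ (fsuc j) (s≤s i≤j) (s≤s j<k) = Equivalence.from (⊨-suc φ a w j) (before j i≤j j<k)

next-last : ∀ φ (a : Letter m) → ((a ∷ []) , fzero ⊨ (Xₗ φ)) ⇔ ⊥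
next-last φ a = mk⇔ (λ { (fzero & () & _) }) λ ()

next-head : ∀ φ a b (w : Vec (Letter m) k) → ((a ∷ b ∷ w) , fzero ⊨ (Xₗ φ)) ⇔ ((b ∷ w) , fzero ⊨ φ)
next-head φ a b w = ⇔-trans (mk⇔ to from) (⊨-suc φ a (b ∷ w) fzero)
  where
  to : (a ∷ b ∷ w) , fzero ⊨ (Xₗ φ) → (a ∷ b ∷ w) , fsuc fzero ⊨ φ
  to (fsuc fzero & _ & s) = s
  from : (a ∷ b ∷ w) , fsuc fzero ⊨ φ → (a ∷ b ∷ w) , fzero ⊨ (Xₗ φ)
  from s = fsuc fzero & refl & s

until-last : ∀ φ ψ (a : Letter m) →
  ((a ∷ []) , fzero ⊨ (φ Uₗ ψ)) ⇔ ((a ∷ []) , fzero ⊨ ψ ⊎ ((a ∷ []) , fzero ⊨ φ × ⊥))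
until-last φ ψ a =
  mk⇔ (λ { (fzero & _ & s & _) → inj₁ s }) λ { (inj₁ s) → fzero & z≤n & s & λ _ _ () }

until-head : ∀ φ ψ a b (w : Vec (Letter m) k) →
  ((a ∷ b ∷ w) , fzero ⊨ (φ Uₗ ψ)) ⇔
  ((a ∷ b ∷ w) , fzero ⊨ ψ ⊎ ((a ∷ b ∷ w) , fzero ⊨ φ × (b ∷ w) , fzero ⊨ (φ Uₗ ψ)))
until-head φ ψ a b w = mk⇔ to from
  where
  v : Vec (Letter _) (suc (suc _))
  v = a ∷ b ∷ w
  shift : ∀ χ j → (v , fsuc j ⊨ χ) ⇔ ((b ∷ w) , j ⊨ χ)
  shift χ = ⊨-suc χ a (b ∷ w)
  to : v , fzero ⊨ (φ Uₗ ψ) → v , fzero ⊨ ψ ⊎ (v , fzero ⊨ φ × (b ∷ w) , fzero ⊨ (φ Uₗ ψ))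
  to (fzero & _ & s & _) = inj₁ s
  to (fsuc k & _ & s & before) =
    inj₂ (before fzero z≤n (s≤s z≤n) &
          k & z≤n & Equivalence.to (shift ψ k) s &
          λ j _ j<k → Equivalence.to (shift φ j) (before (fsuc j) z≤n (s≤s j<k)))
  from : v , fzero ⊨ ψ ⊎ (v , fzero ⊨ φ × (b ∷ w) , fzero ⊨ (φ Uₗ ψ)) → v , fzero ⊨ (φ Uₗ ψ)
  from (inj₁ s) = fzero & z≤n & s & λ _ _ ()
  from (inj₂ (s₀ & k & _ & s & before)) = fsuc k & z≤n & Equivalence.from (shift ψ k) s & before′
    where
    before′ : ∀ j → 0 ℕ.≤ toℕ j → toℕ j ℕ.< suc (toℕ k) → v , j ⊨ φ
    before′ fzero _ _ = s₀
    before′ (fsuc j) _ (s≤s j<k) = Equivalence.from (shift φ j) (before j z≤n j<k)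

⊨⇔Sat : ∀ φ a (w : Vec (Letter m) k) → ((a ∷ w) ⊨ φ) ⇔ Sat φ (a ∷ toList w)
⊨⇔Sat (prop p) a w = ⇔-refl
⊨⇔Sat (¬ₗ φ) a w = ¬-cong-⇔ (⊨⇔Sat φ a w)
⊨⇔Sat (φ ∧ₗ ψ) a w = ⊨⇔Sat φ a w ×-⇔ ⊨⇔Sat ψ a w
⊨⇔Sat (Xₗ φ) a [] = next-last φ a
⊨⇔Sat (Xₗ φ) a (b ∷ w) = ⇔-trans (next-head φ a b w) (⊨⇔Sat φ b w)
⊨⇔Sat (φ Uₗ ψ) a [] = ⇔-trans (until-last φ ψ a) (⊨⇔Sat ψ a [] ⊎-⇔ (⊨⇔Sat φ a [] ×-⇔ ⇔-refl))
⊨⇔Sat (φ Uₗ ψ) a (b ∷ w) =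
  ⇔-trans (until-head φ ψ a b w) (⊨⇔Sat ψ a _ ⊎-⇔ (⊨⇔Sat φ a _ ×-⇔ ⊨⇔Sat (φ Uₗ ψ) b w))

sumV-single : ∀ (t : Vector ℚ n) i → (∀ j → j ≢ i → t j ≡ 0ℚ) → sumV t ≡ t i
sumV-single {suc n} t i others = begin
  sumV t                      ≡⟨ sum-remove t ⟩
  t i + sumV (removeAt t i)   ≡⟨ cong (t i +_) (trans (sum-cong-≗ (λ j → others _ (punchInᵢ≢i i j)))
                                                     (sum-replicate-zero n)) ⟩
  t i + 0ℚ                    ≡⟨ ℚ.+-identityʳ (t i) ⟩
  t i                         ∎

infixl 6 _⊕_
infixr 7 _⊛_

data Affine (n : ℕ) : Set where
  var : Fin n → Affine n
  con : ℚ → Affine n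
  _⊕_ : Affine n → Affine n → Affine n
  _⊛_ : ℚ → Affine n → Affine n

⟦_⟧ : Affine n → Vector ℚ n → ℚ
⟦ var i ⟧ x = x i
⟦ con c ⟧ x = c
⟦ e ⊕ f ⟧ x = ⟦ e ⟧ x + ⟦ f ⟧ x
⟦ c ⊛ e ⟧ x = c * ⟦ e ⟧ x

weights : Affine n → Vector ℚ n
weights (var i) = updateAt (λ _ → 0ℚ) i (λ _ → 1ℚ)
weights (con c) = λ _ → 0ℚ
weights (e ⊕ f) = λ i → weights e i + weights f i
weights (c ⊛ e) = λ i → c * weights e i

offset : Affine n → ℚ
offset (var i) = 0ℚ
offset (con c) = c
offset (e ⊕ f) = offset e + offset f
offset (c ⊛ e) = c * offset e

dot : Vector ℚ n → Vector ℚ n → ℚ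
dot w x = sumV (λ i → w i * x i)

dot-zero : ∀ (x : Vector ℚ n) → dot (λ _ → 0ℚ) x ≡ 0ℚ
dot-zero {n} x = trans (sum-cong-≗ (λ i → ℚ.*-zeroˡ (x i))) (sum-replicate-zero n)

dot-unit : ∀ i (x : Vector ℚ n) → dot (updateAt (λ _ → 0ℚ) i (λ _ → 1ℚ)) x ≡ x i
dot-unit i x = begin
  dot unit x           ≡⟨ sumV-single _ i elsewhere ⟩
  unit i * x i         ≡⟨ cong (_* x i) (updateAt-updates i _) ⟩
  1ℚ * x i             ≡⟨ ℚ.*-identityˡ (x i) ⟩
  x i                  ∎
  where
  unit : Vector ℚ _
  unit = updateAt (λ _ → 0ℚ) i (λ _ → 1ℚ)
  elsewhere : ∀ j → j ≢ i → unit j * x j ≡ 0ℚ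
  elsewhere j j≢i = trans (cong (_* x j) (updateAt-minimal j i _ j≢i)) (ℚ.*-zeroˡ (x j))

dot-+ : ∀ (v w x : Vector ℚ n) → dot (λ i → v i + w i) x ≡ dot v x + dot w x
dot-+ v w x = trans (sum-cong-≗ (λ i → ℚ.*-distribʳ-+ (x i) (v i) (w i)))
                    (∑-distrib-+ (λ i → v i * x i) (λ i → w i * x i))

dot-* : ∀ c (w x : Vector ℚ n) → dot (λ i → c * w i) x ≡ c * dot w x
dot-* c w x =
  trans (sum-cong-≗ (λ i → ℚ.*-assoc c (w i) (x i))) (sym (*-distribˡ-sum c (λ i → w i * x i)))

dot-weights : ∀ (e : Affine n) x → dot (weights e) x + offset e ≡ ⟦ e ⟧ x
dot-weights (var i) x = trans (ℚ.+-identityʳ _) (dot-unit i x)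
dot-weights (con c) x = trans (cong (_+ c) (dot-zero x)) (ℚ.+-identityˡ c)
dot-weights (e ⊕ f) x = begin
  dot (weights (e ⊕ f)) x + (offset e + offset f)
    ≡⟨ cong (_+ _) (dot-+ (weights e) (weights f) x) ⟩
  (dot (weights e) x + dot (weights f) x) + (offset e + offset f)
    ≡⟨ interchange (dot (weights e) x) _ _ _ ⟩
  (dot (weights e) x + offset e) + (dot (weights f) x + offset f)
    ≡⟨ cong₂ _+_ (dot-weights e x) (dot-weights f x) ⟩
  ⟦ e ⟧ x + ⟦ f ⟧ x
    ∎
dot-weights (c ⊛ e) x = begin
  dot (weights (c ⊛ e)) x + c * offset e     ≡⟨ cong (_+ _) (dot-* c (weights e) x) ⟩
  c * dot (weights e) x + c * offset e       ≡⟨ sym (ℚ.*-distribˡ-+ c _ _) ⟩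
  c * (dot (weights e) x + offset e)         ≡⟨ cong (c *_) (dot-weights e x) ⟩
  c * ⟦ e ⟧ x                                ∎

affineLayer : (Fin k → Affine n) → Layer n k
affineLayer e = record { weight = λ i → weights (e i) ; bias = λ i → offset (e i) }

evalLayer-affine : ∀ (e : Fin k → Affine n) x i → evalLayer (affineLayer e) x i ≡ relu (⟦ e i ⟧ x)
evalLayer-affine e x i = cong relu (dot-weights (e i) x)

rename : (Fin n → Fin k) → Affine n → Affine k
rename ρ (var i) = var (ρ i)
rename ρ (con c) = con c
rename ρ (e ⊕ f) = rename ρ e ⊕ rename ρ f
rename ρ (c ⊛ e) = c ⊛ rename ρ e

⟦rename⟧ : ∀ (ρ : Fin n → Fin k) e {x y} → (∀ i → x (ρ i) ≡ y i) → ⟦ rename ρ e ⟧ x ≡ ⟦ e ⟧ y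
⟦rename⟧ ρ (var i) x∘ρ≗y = x∘ρ≗y i
⟦rename⟧ ρ (con c) x∘ρ≗y = refl
⟦rename⟧ ρ (e ⊕ f) x∘ρ≗y = cong₂ _+_ (⟦rename⟧ ρ e x∘ρ≗y) (⟦rename⟧ ρ f x∘ρ≗y)
⟦rename⟧ ρ (c ⊛ e) x∘ρ≗y = cong (c *_) (⟦rename⟧ ρ e x∘ρ≗y)

-- F a u is the vector at the step where a is read, u being the letters read before it, most
-- recent first.  On the reversed word a ∷ u is therefore a suffix of the original word.
Stream : ℕ → ℕ → Set
Stream m d = Letter m → List (Letter m) → Vector ℚ d

layerState : SSMLayer d → Stream m d → List (Letter m) → Vector ℚ d
layerState l F [] = SSMLayer.h₀ l
layerState l F (a ∷ u) i =
  matVec (gateMatrix l (F a u)) (layerState l F u) i + eval (SSMLayer.inc l) (F a u) i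

applyLayer : SSMLayer d → Stream m d → Stream m d
applyLayer l F a u = eval (SSMLayer.φ l) (layerState l F (a ∷ u) VF.++ F a u)

applyLayers : List (SSMLayer d) → Stream m d → Stream m d
applyLayers [] F = F
applyLayers (l ∷ ls) F = applyLayers ls (applyLayer l F)

applyLayers-++ : ∀ (ls ks : List (SSMLayer d)) (F : Stream m d) →
  applyLayers (ls ++ ks) F ≡ applyLayers ks (applyLayers ls F)
applyLayers-++ [] ks F = refl
applyLayers-++ (l ∷ ls) ks F = applyLayers-++ ls ks (applyLayer l F)

trace : Stream m d → List (Letter m) → Vec (Letter m) k → Vec (Vector ℚ d) k
trace F h [] = []
trace F h (c ∷ cs) = F c h ∷ trace F (c ∷ h) cs

runLayer-trace : ∀ l (F : Stream m d) h (cs : Vec (Letter m) k) →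
  runLayer l (layerState l F h) (trace F h cs) ≡ trace (applyLayer l F) h cs
runLayer-trace l F h [] = refl
runLayer-trace l F h (c ∷ cs) = cong (_ ∷_) (runLayer-trace l F (c ∷ h) cs)

runLayers-trace : ∀ ls (F : Stream m d) (cs : Vec (Letter m) k) →
  runLayers ls (trace F [] cs) ≡ trace (applyLayers ls F) [] cs
runLayers-trace [] F cs = refl
runLayers-trace (l ∷ ls) F cs =
  trans (cong (runLayers ls) (runLayer-trace l F [] cs)) (runLayers-trace ls (applyLayer l F) cs)

map-trace : ∀ (emb : Letter m → Vector ℚ d) h (cs : Vec (Letter m) k) →
  Vec.map emb cs ≡ trace (λ a _ → emb a) h cs
map-trace emb h [] = refl
map-trace emb h (c ∷ cs) = cong (emb c ∷_) (map-trace emb (c ∷ h) cs)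

trace-∷ʳ : ∀ (F : Stream m d) h (cs : Vec (Letter m) k) c →
  trace F h (cs ∷ʳ c) ≡ trace F h cs ∷ʳ F c (toList cs ʳ++ h)
trace-∷ʳ F h [] c = refl
trace-∷ʳ F h (c′ ∷ cs) c = cong (F c′ h ∷_) (trace-∷ʳ F (c′ ∷ h) cs c)

last-trace-reverse : ∀ (F : Stream m d) a (w : Vec (Letter m) k) →
  last (trace F [] (reverse (a ∷ w))) ≡ F a (toList w)
last-trace-reverse F a w = begin
  last (trace F [] (reverse (a ∷ w)))
    ≡⟨ cong (last ∘ trace F []) (reverse-∷ a w) ⟩
  last (trace F [] (reverse w ∷ʳ a))
    ≡⟨ cong last (trace-∷ʳ F [] (reverse w) a) ⟩
  last (trace F [] (reverse w) ∷ʳ F a (List.reverse (toList (reverse w))))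
    ≡⟨ last-∷ʳ _ (trace F [] (reverse w)) ⟩
  F a (List.reverse (toList (reverse w)))
    ≡⟨ cong (F a ∘ List.reverse) (toList-reverse w) ⟩
  F a (List.reverse (List.reverse (toList w)))
    ≡⟨ cong (F a) (reverse-involutive (toList w)) ⟩
  F a (toList w)
    ∎

runSSM-reverse : ∀ (S : SSM m) a (w : Vec (Letter m) k) →
  runSSM S (reverse (a ∷ w)) ≡
  eval (SSM.out S) (applyLayers (SSM.layers S) (λ b _ → SSM.emb S b) a (toList w)) fzero
runSSM-reverse S a w = cong (λ x → eval (SSM.out S) x fzero) (begin
  last (runLayers ls (Vec.map (SSM.emb S) (reverse (a ∷ w))))
    ≡⟨ cong (last ∘ runLayers ls) (map-trace (SSM.emb S) [] (reverse (a ∷ w))) ⟩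
  last (runLayers ls (trace E [] (reverse (a ∷ w))))
    ≡⟨ cong last (runLayers-trace ls E (reverse (a ∷ w))) ⟩
  last (trace (applyLayers ls E) [] (reverse (a ∷ w)))
    ≡⟨ last-trace-reverse (applyLayers ls E) a w ⟩
  applyLayers ls E a (toList w)
    ∎)
  where
  ls : List (SSMLayer (SSM.d S))
  ls = SSM.layers S
  E : Stream _ (SSM.d S)
  E b _ = SSM.emb S b

2ℚ 3ℚ ⅓ : ℚ
2ℚ = ℤ.+ 2 / 1
3ℚ = ℤ.+ 3 / 1
⅓ = ℤ.+ 1 / 3

Bit : ℚ → Set
Bit q = q ≡ 0ℚ ⊎ q ≡ 1ℚ

infix 4 _encodes_ _remembers_

_encodes_ : ℚ → Set → Set
q encodes P = (q ≡ 1ℚ × P) ⊎ (q ≡ 0ℚ × ¬ P)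

encodes⇒Bit : ∀ {q P} → q encodes P → Bit q
encodes⇒Bit (inj₁ (q≡1 & _)) = inj₂ q≡1
encodes⇒Bit (inj₂ (q≡0 & _)) = inj₁ q≡0

encodes⇒⇔ : ∀ {q P} → q encodes P → P ⇔ (q ≡ 1ℚ)
encodes⇒⇔ (inj₁ (q≡1 & p)) = mk⇔ (λ _ → q≡1) (λ _ → p)
encodes⇒⇔ (inj₂ (refl & ¬p)) = mk⇔ (⊥-elim ∘ ¬p) λ ()

indicator : ∀ {P : Set} → Dec P → ℚ
indicator (yes _) = 1ℚ
indicator (no _) = 0ℚ

indicator-encodes : ∀ {P : Set} (P? : Dec P) → indicator P? encodes P
indicator-encodes (yes p) = inj₁ (refl & p)
indicator-encodes (no ¬p) = inj₂ (refl & ¬p)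

relu-Bit : ∀ {q} → Bit q → relu q ≡ q
relu-Bit (inj₁ refl) = refl
relu-Bit (inj₂ refl) = refl

-- min (max q 0) 1
clamp : ℚ → ℚ
clamp q = relu (relu q + - 1ℚ * relu (q + - 1ℚ))

clamp-Bit : ∀ {q} → Bit q → clamp q ≡ q
clamp-Bit (inj₁ refl) = refl
clamp-Bit (inj₂ refl) = refl

clamp-≤0 : ∀ {q} → q ≤ 0ℚ → clamp q ≡ 0ℚ
clamp-≤0 q≤0 = cong₂ (λ x y → relu (x + - 1ℚ * y)) (ℚ.p≤q⇒p⊔q≡q q≤0)
  (ℚ.p≤q⇒p⊔q≡q (ℚ.+-mono-≤ q≤0 (ℚ.nonPositive⁻¹ (- 1ℚ))))

clamp-≥1 : ∀ {q} → 1ℚ ≤ q → clamp q ≡ 1ℚ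
clamp-≥1 {q} 1≤q = begin
  clamp q
    ≡⟨ cong₂ (λ x y → relu (x + - 1ℚ * y)) (ℚ.p≥q⇒p⊔q≡p 0≤q) (ℚ.p≥q⇒p⊔q≡p 0≤q-1) ⟩
  relu (q + - 1ℚ * (q + - 1ℚ))
    ≡⟨ cong relu (solve 1 (λ q → q :+ lit (- 1ℚ) :* (q :+ lit (- 1ℚ)) := lit 1ℚ) refl q) ⟩
  relu 1ℚ
    ∎
  where
  0≤q : 0ℚ ≤ q
  0≤q = ℚ.≤-trans (ℚ.≤ᵇ⇒≤ tt) 1≤q
  0≤q-1 : 0ℚ ≤ q + - 1ℚ
  0≤q-1 = ℚ.+-monoˡ-≤ (- 1ℚ) 1≤q

negation-encodes : ∀ {q P} → q encodes P → clamp (1ℚ + - 1ℚ * q) encodes (¬ P)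
negation-encodes (inj₁ (refl & p)) = inj₂ (refl & λ ¬p → ¬p p)
negation-encodes (inj₂ (refl & ¬p)) = inj₁ (refl & ¬p)

conjunction-encodes : ∀ {p q P Q} → p encodes P → q encodes Q → clamp (p + q + - 1ℚ) encodes (P × Q)
conjunction-encodes (inj₁ (refl & p)) (inj₁ (refl & q)) = inj₁ (refl & (p & q))
conjunction-encodes (inj₁ (refl & _)) (inj₂ (refl & ¬q)) = inj₂ (refl & (¬q ∘ proj₂))
conjunction-encodes (inj₂ (refl & ¬p)) (inj₁ (refl & _)) = inj₂ (refl & (¬p ∘ proj₁))
conjunction-encodes (inj₂ (refl & ¬p)) (inj₂ (refl & _)) = inj₂ (refl & (¬p ∘ proj₁))

until-encodes : ∀ {p q h P Q H} → p encodes P → q encodes Q → h encodes H →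
  relu (p + - 1ℚ * q) * h + relu q encodes (Q ⊎ (P × H))
until-encodes (inj₁ (refl & _)) (inj₁ (refl & q)) (inj₁ (refl & _)) = inj₁ (refl & inj₁ q)
until-encodes (inj₁ (refl & _)) (inj₁ (refl & q)) (inj₂ (refl & _)) = inj₁ (refl & inj₁ q)
until-encodes (inj₂ (refl & _)) (inj₁ (refl & q)) (inj₁ (refl & _)) = inj₁ (refl & inj₁ q)
until-encodes (inj₂ (refl & _)) (inj₁ (refl & q)) (inj₂ (refl & _)) = inj₁ (refl & inj₁ q)
until-encodes (inj₁ (refl & p)) (inj₂ (refl & _)) (inj₁ (refl & h)) = inj₁ (refl & inj₂ (p & h))
until-encodes (inj₁ (refl & _)) (inj₂ (refl & ¬q)) (inj₂ (refl & ¬h)) = inj₂ (refl & [ ¬q , ¬h ∘ proj₂ ])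
until-encodes (inj₂ (refl & ¬p)) (inj₂ (refl & ¬q)) (inj₁ (refl & _)) = inj₂ (refl & [ ¬q , ¬p ∘ proj₁ ])
until-encodes (inj₂ (refl & ¬p)) (inj₂ (refl & ¬q)) (inj₂ (refl & _)) = inj₂ (refl & [ ¬q , ¬p ∘ proj₁ ])

Between : ℚ → ℚ → ℚ → Set
Between lo hi x = lo ≤ x × x ≤ hi

-- The X-layer state h′ = h/3 + 2q sends [0,3] into [2,3] when q = 1 and into [0,1] when q = 0.
_remembers_ : ℚ → Set → Set
h remembers P = (P × Between 2ℚ 3ℚ h) ⊎ (¬ P × Between 0ℚ 1ℚ h)

remembers-bounds : ∀ {h P} → h remembers P → Between 0ℚ 3ℚ h
remembers-bounds (inj₁ (_ & 2≤h & h≤3)) = ℚ.≤-trans (ℚ.≤ᵇ⇒≤ tt) 2≤h & h≤3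
remembers-bounds (inj₂ (_ & 0≤h & h≤1)) = 0≤h & ℚ.≤-trans h≤1 (ℚ.≤ᵇ⇒≤ tt)

⅓*-Between : ∀ {h} → Between 0ℚ 3ℚ h → Between 0ℚ 1ℚ (⅓ * h)
⅓*-Between (0≤h & h≤3) = ℚ.*-monoˡ-≤-nonNeg ⅓ 0≤h & ℚ.*-monoˡ-≤-nonNeg ⅓ h≤3

+-Between : ∀ c {x lo hi} → Between lo hi x → Between (lo + c) (hi + c) (x + c)
+-Between c (lo≤x & x≤hi) = ℚ.+-monoˡ-≤ c lo≤x & ℚ.+-monoˡ-≤ c x≤hi

remember : ∀ {h q P Q} → h remembers P → q encodes Q → ⅓ * h + relu (2ℚ * q) remembers Q
remember h∼P (inj₁ (refl & q)) = inj₁ (q & +-Between 2ℚ (⅓*-Between (remembers-bounds h∼P)))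
remember h∼P (inj₂ (refl & ¬q)) = inj₂ (¬q & +-Between 0ℚ (⅓*-Between (remembers-bounds h∼P)))

recall : ∀ {h P} → h remembers P → clamp (h + - 1ℚ) encodes P
recall (inj₁ (p & 2≤h & _)) = inj₁ (clamp-≥1 (ℚ.+-monoˡ-≤ (- 1ℚ) 2≤h) & p)
recall (inj₂ (¬p & _ & h≤1)) = inj₂ (clamp-≤0 (ℚ.+-monoˡ-≤ (- 1ℚ) h≤1) & ¬p)

recall-previous : ∀ {h q P Q} → h remembers P → q encodes Q →
  clamp (3ℚ * ((⅓ * h + relu (2ℚ * q)) + - 2ℚ * q) + - 1ℚ) encodes P
recall-previous {h} {q} h∼P q∼Q = subst (λ x → clamp x encodes _) (sym (undo q∼Q)) (recall h∼P)
  where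
  undo : ∀ {Q} → q encodes Q → 3ℚ * ((⅓ * h + relu (2ℚ * q)) + - 2ℚ * q) + - 1ℚ ≡ h + - 1ℚ
  undo (inj₁ (refl & _)) =
    solve 1 (λ h → lit 3ℚ :* ((lit ⅓ :* h :+ lit 2ℚ) :+ lit (- 2ℚ)) :+ lit (- 1ℚ) := h :+ lit (- 1ℚ)) refl h
  undo (inj₂ (refl & _)) =
    solve 1 (λ h → lit 3ℚ :* ((lit ⅓ :* h :+ lit 0ℚ) :+ lit 0ℚ) :+ lit (- 1ℚ) := h :+ lit (- 1ℚ)) refl h

record SlotUpdate (d : ℕ) : Set where
  field
    decay input : Affine d
    -- variable zero is the updated state at the slot, variable suc i is input coordinate i
    readout : Affine (suc d)

open SlotUpdate

module _ {d : ℕ} (t : Fin d) (g : SlotUpdate d) where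

  slotView : Fin (suc d) → Fin (d ℕ.+ d)
  slotView fzero = t ↑ˡ d
  slotView (fsuc i) = d ↑ʳ i

  readoutForm : Affine (d ℕ.+ d)
  readoutForm = rename slotView (readout g)

  gateForms : Fin (d ℕ.* d) → Affine d
  gateForms = updateAt (λ _ → con 0ℚ) (combine t t) (λ _ → decay g)

  incForms : Fin d → Affine d
  incForms = updateAt (λ _ → con 0ℚ) t (λ _ → input g)

  hiddenForms : Fin (suc d) → Affine (d ℕ.+ d)
  hiddenForms fzero = readoutForm ⊕ con (- 1ℚ)
  hiddenForms (fsuc k) = updateAt (λ k → var (d ↑ʳ k)) t (λ _ → readoutForm) k

  outputForms : Fin d → Affine (suc d)
  outputForms = updateAt (λ k → var (fsuc k)) t (λ _ → var (fsuc t) ⊕ (- 1ℚ) ⊛ var fzero)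

  writeLayer : SSMLayer d
  writeLayer = record
    { h₀   = λ _ → 0ℚ
    ; gate = single (affineLayer gateForms)
    ; inc  = single (affineLayer incForms)
    ; φ    = single (affineLayer hiddenForms) ▷ affineLayer outputForms
    }

  writeLayer-diagonal : IsDiagLayer writeLayer
  writeLayer-diagonal x i j i≢j = begin
    gateMatrix writeLayer x i j          ≡⟨ evalLayer-affine gateForms x (combine i j) ⟩
    relu (⟦ gateForms (combine i j) ⟧ x) ≡⟨ cong (λ e → relu (⟦ e ⟧ x)) (updateAt-minimal _ _ _ off-diag) ⟩
    relu 0ℚ                              ≡⟨⟩
    0ℚ                                   ∎
    where
    off-diag : combine i j ≢ combine t t
    off-diag eq with combine-injective i j t t eq
    ... | refl & refl = i≢j refl

  gate-slot : ∀ x → gateMatrix writeLayer x t t ≡ relu (⟦ decay g ⟧ x)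
  gate-slot x = trans (evalLayer-affine gateForms x (combine t t))
                      (cong (λ e → relu (⟦ e ⟧ x)) (updateAt-updates (combine t t) _))

  layerState-slot : ∀ {m} (F : Stream m d) a u →
    layerState writeLayer F (a ∷ u) t ≡
    relu (⟦ decay g ⟧ (F a u)) * layerState writeLayer F u t + relu (⟦ input g ⟧ (F a u))
  layerState-slot F a u = cong₂ _+_ diagonal-term increment
    where
    x h : Vector ℚ d
    x = F a u
    h = layerState writeLayer F u
    diagonal-term : matVec (gateMatrix writeLayer x) h t ≡ relu (⟦ decay g ⟧ x) * h t
    diagonal-term = trans (sumV-single _ t off-diagonal) (cong (_* h t) (gate-slot x))
      where
      off-diagonal : ∀ j → j ≢ t → gateMatrix writeLayer x t j * h j ≡ 0ℚ
      off-diagonal j j≢t =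
        trans (cong (_* h j) (writeLayer-diagonal x t j (≢-sym j≢t))) (ℚ.*-zeroˡ (h j))
    increment : eval (SSMLayer.inc writeLayer) x t ≡ relu (⟦ input g ⟧ x)
    increment =
      trans (evalLayer-affine incForms x t) (cong (λ e → relu (⟦ e ⟧ x)) (updateAt-updates t _))

  ⟦readoutForm⟧ : ∀ (h x : Vector ℚ d) → ⟦ readoutForm ⟧ (h VF.++ x) ≡ ⟦ readout g ⟧ (h t VF.∷ x)
  ⟦readoutForm⟧ h x = ⟦rename⟧ slotView (readout g) view
    where
    view : ∀ i → (h VF.++ x) (slotView i) ≡ (h t VF.∷ x) i
    view fzero = lookup-++ˡ h x t
    view (fsuc i) = lookup-++ʳ h x i

  applyLayer-slot : ∀ {m} (F : Stream m d) a u →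
    applyLayer writeLayer F a u t ≡ clamp (⟦ readout g ⟧ (layerState writeLayer F (a ∷ u) t VF.∷ F a u))
  applyLayer-slot F a u = begin
    applyLayer writeLayer F a u t
      ≡⟨ evalLayer-affine outputForms z t ⟩
    relu (⟦ outputForms t ⟧ z)
      ≡⟨ cong (λ e → relu (⟦ e ⟧ z)) (updateAt-updates t _) ⟩
    relu (z (fsuc t) + - 1ℚ * z fzero)
      ≡⟨ cong₂ (λ p q → relu (p + - 1ℚ * q)) readout-node shifted-node ⟩
    clamp r
      ∎
    where
    y : Vector ℚ (d ℕ.+ d)
    y = layerState writeLayer F (a ∷ u) VF.++ F a u
    z : Vector ℚ (suc d)
    z = evalLayer (affineLayer hiddenForms) y
    r : ℚ
    r = ⟦ readout g ⟧ (layerState writeLayer F (a ∷ u) t VF.∷ F a u)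
    readout-node : z (fsuc t) ≡ relu r
    readout-node = trans (evalLayer-affine hiddenForms y (fsuc t))
      (cong relu (trans (cong (λ e → ⟦ e ⟧ y) (updateAt-updates t _)) (⟦readoutForm⟧ _ _)))
    shifted-node : z fzero ≡ relu (r + - 1ℚ)
    shifted-node =
      trans (evalLayer-affine hiddenForms y fzero) (cong (λ q → relu (q + - 1ℚ)) (⟦readoutForm⟧ _ _))

  applyLayer-other : ∀ {m} (F : Stream m d) a u k → k ≢ t →
    applyLayer writeLayer F a u k ≡ relu (relu (F a u k))
  applyLayer-other F a u k k≢t = begin
    applyLayer writeLayer F a u k
      ≡⟨ evalLayer-affine outputForms z k ⟩
    relu (⟦ outputForms k ⟧ z)
      ≡⟨ cong (λ e → relu (⟦ e ⟧ z)) (updateAt-minimal k t _ k≢t) ⟩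
    relu (z (fsuc k))
      ≡⟨ cong relu (evalLayer-affine hiddenForms y (fsuc k)) ⟩
    relu (relu (⟦ hiddenForms (fsuc k) ⟧ y))
      ≡⟨ cong (λ e → relu (relu (⟦ e ⟧ y))) (updateAt-minimal k t _ k≢t) ⟩
    relu (relu (y (d ↑ʳ k)))
      ≡⟨ cong (relu ∘ relu) (lookup-++ʳ (layerState writeLayer F (a ∷ u)) (F a u) k) ⟩
    relu (relu (F a u k))
      ∎
    where
    y : Vector ℚ (d ℕ.+ d)
    y = layerState writeLayer F (a ∷ u) VF.++ F a u
    z : Vector ℚ (suc d)
    z = evalLayer (affineLayer hiddenForms) y

infix 4 _⊩_∶_

record _⊩_∶_ (F : Stream m d) (i : Fin d) (P : List (Letter m) → Set) : Set where
  constructor mk⊩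
  field
    encoded : ∀ a u → F a u i encodes P (a ∷ u)

open _⊩_∶_

Boolean : Stream m d → Set
Boolean F = ∀ a u i → Bit (F a u i)

module _ {F : Stream m d} (t : Fin d) (g : SlotUpdate d) where

  writeLayer-⊩ : ∀ {P} →
    (∀ a u → clamp (⟦ readout g ⟧ (layerState (writeLayer t g) F (a ∷ u) t VF.∷ F a u))
               encodes P (a ∷ u)) →
    applyLayer (writeLayer t g) F ⊩ t ∶ P
  writeLayer-⊩ {P} readout-encodes =
    mk⊩ λ a u → subst (_encodes P (a ∷ u)) (sym (applyLayer-slot t g F a u)) (readout-encodes a u)

  writeLayer-frame : Boolean F → ∀ a u k → k ≢ t → applyLayer (writeLayer t g) F a u k ≡ F a u k
  writeLayer-frame F-boolean a u k k≢t =
    trans (applyLayer-other t g F a u k k≢t) (trans (cong relu (relu-Bit bit)) (relu-Bit bit))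
    where
    bit : Bit (F a u k)
    bit = F-boolean a u k

copy : Fin d → SlotUpdate d
copy r = record { decay = con 0ℚ ; input = con 0ℚ ; readout = var (fsuc r) }

negation : Fin d → SlotUpdate d
negation r = record { decay = con 0ℚ ; input = con 0ℚ ; readout = con 1ℚ ⊕ (- 1ℚ) ⊛ var (fsuc r) }

conjunction : Fin d → Fin d → SlotUpdate d
conjunction r s = record
  { decay = con 0ℚ ; input = con 0ℚ ; readout = var (fsuc r) ⊕ var (fsuc s) ⊕ con (- 1ℚ) }

next : Fin d → SlotUpdate d
next r = record
  { decay   = con ⅓
  ; input   = 2ℚ ⊛ var r
  ; readout = 3ℚ ⊛ (var fzero ⊕ (- 2ℚ) ⊛ var (fsuc r)) ⊕ con (- 1ℚ)
  }

until : Fin d → Fin d → SlotUpdate d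
until r s = record { decay = var r ⊕ (- 1ℚ) ⊛ var s ; input = var s ; readout = var fzero }

module _ {F : Stream m d} {r t : Fin d} where

  copy-⊩ : ∀ {P} → F ⊩ r ∶ P → applyLayer (writeLayer t (copy r)) F ⊩ t ∶ P
  copy-⊩ F⊩r = writeLayer-⊩ t (copy r) λ a u →
    subst (_encodes _) (sym (clamp-Bit (encodes⇒Bit (encoded F⊩r a u)))) (encoded F⊩r a u)

  negation-⊩ : ∀ {φ} → F ⊩ r ∶ Sat φ → applyLayer (writeLayer t (negation r)) F ⊩ t ∶ Sat (¬ₗ φ)
  negation-⊩ F⊩r = writeLayer-⊩ t (negation r) λ a u → negation-encodes (encoded F⊩r a u)

  conjunction-⊩ : ∀ {s φ ψ} → F ⊩ r ∶ Sat φ → F ⊩ s ∶ Sat ψ →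
    applyLayer (writeLayer t (conjunction r s)) F ⊩ t ∶ Sat (φ ∧ₗ ψ)
  conjunction-⊩ {s} F⊩r F⊩s =
    writeLayer-⊩ t (conjunction r s) λ a u → conjunction-encodes (encoded F⊩r a u) (encoded F⊩s a u)

  next-⊩ : ∀ {φ} → F ⊩ r ∶ Sat φ → applyLayer (writeLayer t (next r)) F ⊩ t ∶ Sat (Xₗ φ)
  next-⊩ {φ} F⊩r = writeLayer-⊩ t (next r) λ a u →
    subst (λ h → clamp (3ℚ * (h + - 2ℚ * F a u r) + - 1ℚ) encodes Sat φ u)
      (sym (layerState-slot t (next r) F a u)) (recall-previous (memory u) (encoded F⊩r a u))
    where
    memory : ∀ u → layerState (writeLayer t (next r)) F u t remembers Sat φ u
    memory [] = inj₂ ((λ ()) & ℚ.≤-refl & ℚ.≤ᵇ⇒≤ tt)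
    memory (a ∷ u) = subst (_remembers _) (sym (layerState-slot t (next r) F a u))
                       (remember (memory u) (encoded F⊩r a u))

  until-⊩ : ∀ {s φ ψ} → F ⊩ r ∶ Sat φ → F ⊩ s ∶ Sat ψ →
    applyLayer (writeLayer t (until r s)) F ⊩ t ∶ Sat (φ Uₗ ψ)
  until-⊩ {s} {φ} {ψ} F⊩r F⊩s = writeLayer-⊩ t (until r s) λ a u →
    subst (_encodes _) (sym (clamp-Bit (encodes⇒Bit (memory (a ∷ u))))) (memory (a ∷ u))
    where
    memory : ∀ u → layerState (writeLayer t (until r s)) F u t encodes Sat (φ Uₗ ψ) u
    memory [] = inj₂ (refl & λ ())
    memory (a ∷ u) = subst (_encodes _) (sym (layerState-slot t (until r s) F a u))
                       (until-encodes (encoded F⊩r a u) (encoded F⊩s a u) (memory u))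

Avoids : (Fin n → Fin d) → Fin d → Set
Avoids σ i = ∀ k → σ k ≢ i

record Computes (σ : Fin (suc n) → Fin d) (P : List (Letter m) → Set) (F G : Stream m d) : Set where
  field
    boolean : Boolean G
    result  : G ⊩ σ fzero ∶ P
    frame   : ∀ i → Avoids σ i → ∀ a u → G a u i ≡ F a u i

open Computes

⊩-frame : ∀ {F G : Stream m d} {i P} → (∀ a u → G a u i ≡ F a u i) → F ⊩ i ∶ P → G ⊩ i ∶ P
⊩-frame {P = P} G≡F F⊩i = mk⊩ λ a u → subst (_encodes P (a ∷ u)) (sym (G≡F a u)) (encoded F⊩i a u)

↑ˡ≢↑ʳ : ∀ {j k} (i : Fin j) (i′ : Fin k) → i ↑ˡ k ≢ j ↑ʳ i′
↑ˡ≢↑ʳ {j} {k} i i′ eq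
  with trans (sym (splitAt-↑ˡ j i k)) (trans (cong (splitAt j) eq) (splitAt-↑ʳ j k i′))
... | ()

module _ {σ : Fin (suc n) → Fin d} {F G : Stream m d} {P : List (Letter m) → Set} (g : SlotUpdate d) where

  writeLayer-computes : Boolean G → applyLayer (writeLayer (σ fzero) g) G ⊩ σ fzero ∶ P →
    (∀ i → Avoids σ i → ∀ a u → G a u i ≡ F a u i) → Computes σ P F (applyLayer (writeLayer (σ fzero) g) G)
  writeLayer-computes G-boolean written G-frame = record
    { boolean = boolean′
    ; result  = written
    ; frame   = λ i σ∌i a u →
        trans (writeLayer-frame (σ fzero) g G-boolean a u i (σ∌i fzero ∘ sym)) (G-frame i σ∌i a u)
    }
    where
    boolean′ : Boolean (applyLayer (writeLayer (σ fzero) g) G)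
    boolean′ a u k with k Fin.≟ σ fzero
    ... | yes refl = encodes⇒Bit (encoded written a u)
    ... | no k≢t = subst Bit (sym (writeLayer-frame (σ fzero) g G-boolean a u k k≢t)) (G-boolean a u k)

descendants : LTL m → ℕ
descendants (prop p) = 0
descendants (¬ₗ φ) = suc (descendants φ)
descendants (φ ∧ₗ ψ) = suc (descendants φ) ℕ.+ suc (descendants ψ)
descendants (Xₗ φ) = suc (descendants φ)
descendants (φ Uₗ ψ) = suc (descendants φ) ℕ.+ suc (descendants ψ)

module Compilation {m d : ℕ} (atomSlot : Fin m → Fin d) where

  -- σ : Slots φ places the subformula occurrences of φ, in preorder, σ zero being φ itself.
  Slots : LTL m → Set
  Slots φ = Fin (suc (descendants φ)) → Fin d

  BinarySlots : LTL m → LTL m → Set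
  BinarySlots φ ψ = Fin (suc (suc (descendants φ) ℕ.+ suc (descendants ψ))) → Fin d

  leftSlots : ∀ φ ψ → BinarySlots φ ψ → Slots φ
  leftSlots φ ψ σ = σ ∘ fsuc ∘ (_↑ˡ suc (descendants ψ))

  rightSlots : ∀ φ ψ → BinarySlots φ ψ → Slots ψ
  rightSlots φ ψ σ = σ ∘ fsuc ∘ (suc (descendants φ) ↑ʳ_)

  compile : (φ : LTL m) → Slots φ → List (SSMLayer d)
  unaryNode : (φ : LTL m) → (Fin (suc (suc (descendants φ))) → Fin d) → (Fin d → SlotUpdate d) →
    List (SSMLayer d)
  binaryNode : (φ ψ : LTL m) → BinarySlots φ ψ → (Fin d → Fin d → SlotUpdate d) → List (SSMLayer d)

  compile (prop p) σ = writeLayer (σ fzero) (copy (atomSlot p)) ∷ []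
  compile (¬ₗ φ) σ = unaryNode φ σ negation
  compile (φ ∧ₗ ψ) σ = binaryNode φ ψ σ conjunction
  compile (Xₗ φ) σ = unaryNode φ σ next
  compile (φ Uₗ ψ) σ = binaryNode φ ψ σ until

  unaryNode φ σ op = compile φ (σ ∘ fsuc) ++ writeLayer (σ fzero) (op (σ (fsuc fzero))) ∷ []

  binaryNode φ ψ σ op =
    compile φ (leftSlots φ ψ σ) ++ compile ψ (rightSlots φ ψ σ) ++
    writeLayer (σ fzero) (op (leftSlots φ ψ σ fzero) (rightSlots φ ψ σ fzero)) ∷ []

  compile-diagonal : ∀ φ σ → All IsDiagLayer (compile φ σ)
  unaryNode-diagonal : ∀ φ σ op → All IsDiagLayer (unaryNode φ σ op)
  binaryNode-diagonal : ∀ φ ψ σ op → All IsDiagLayer (binaryNode φ ψ σ op)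

  compile-diagonal (prop p) σ = writeLayer-diagonal (σ fzero) (copy (atomSlot p)) ∷ []
  compile-diagonal (¬ₗ φ) σ = unaryNode-diagonal φ σ negation
  compile-diagonal (φ ∧ₗ ψ) σ = binaryNode-diagonal φ ψ σ conjunction
  compile-diagonal (Xₗ φ) σ = unaryNode-diagonal φ σ next
  compile-diagonal (φ Uₗ ψ) σ = binaryNode-diagonal φ ψ σ until

  unaryNode-diagonal φ σ op =
    ++⁺ (compile-diagonal φ (σ ∘ fsuc)) (writeLayer-diagonal (σ fzero) (op (σ (fsuc fzero))) ∷ [])

  binaryNode-diagonal φ ψ σ op =
    ++⁺ (compile-diagonal φ (leftSlots φ ψ σ)) (++⁺ (compile-diagonal ψ (rightSlots φ ψ σ))
        (writeLayer-diagonal (σ fzero) (op (leftSlots φ ψ σ fzero) (rightSlots φ ψ σ fzero)) ∷ []))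

  record Fresh (σ : Fin (suc n) → Fin d) : Set where
    field
      injective    : Injective _≡_ _≡_ σ
      avoids-atoms : ∀ p → Avoids σ (atomSlot p)

  record EncodesAtoms (F : Stream m d) : Set where
    field
      bits  : Boolean F
      atoms : ∀ p → F ⊩ atomSlot p ∶ Sat (prop p)

  open Fresh
  open EncodesAtoms

  fresh-suc : ∀ {σ : Fin (suc (suc n)) → Fin d} → Fresh σ → Fresh (σ ∘ fsuc)
  fresh-suc fr = record
    { injective = suc-injective ∘ injective fr ; avoids-atoms = λ p → avoids-atoms fr p ∘ fsuc }

  fresh-left : ∀ φ ψ {σ : BinarySlots φ ψ} → Fresh σ → Fresh (leftSlots φ ψ σ)
  fresh-left φ ψ fr = record
    { injective = ↑ˡ-injective _ _ _ ∘ suc-injective ∘ injective fr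
    ; avoids-atoms = λ p → avoids-atoms fr p ∘ fsuc ∘ (_↑ˡ _) }

  fresh-right : ∀ φ ψ {σ : BinarySlots φ ψ} → Fresh σ → Fresh (rightSlots φ ψ σ)
  fresh-right φ ψ fr = record
    { injective = ↑ʳ-injective _ _ _ ∘ suc-injective ∘ injective fr
    ; avoids-atoms = λ p → avoids-atoms fr p ∘ fsuc ∘ (suc (descendants φ) ↑ʳ_) }

  encodesAtoms-frame : ∀ {σ : Fin (suc n) → Fin d} {P F G} →
    Fresh σ → EncodesAtoms F → Computes σ P F G → EncodesAtoms G
  encodesAtoms-frame fr enc C = record
    { bits = boolean C ; atoms = λ p → ⊩-frame (frame C (atomSlot p) (avoids-atoms fr p)) (atoms enc p) }

  unaryNode-computes : ∀ {σ : Fin (suc (suc n)) → Fin d} {F G : Stream m d} {P Q : List (Letter m) → Set}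
    (g : SlotUpdate d) → Computes (σ ∘ fsuc) Q F G →
    (G ⊩ σ (fsuc fzero) ∶ Q → applyLayer (writeLayer (σ fzero) g) G ⊩ σ fzero ∶ P) →
    Computes σ P F (applyLayer (writeLayer (σ fzero) g) G)
  unaryNode-computes g C gadget =
    writeLayer-computes g (boolean C) (gadget (result C)) (λ i σ∌i → frame C i (σ∌i ∘ fsuc))

  binaryNode-computes : ∀ φ ψ {σ : BinarySlots φ ψ} {F G₁ G₂ : Stream m d} {P Q R : List (Letter m) → Set}
    (g : SlotUpdate d) → Injective _≡_ _≡_ σ →
    Computes (leftSlots φ ψ σ) P F G₁ → Computes (rightSlots φ ψ σ) Q G₁ G₂ →
    (G₂ ⊩ leftSlots φ ψ σ fzero ∶ P → G₂ ⊩ rightSlots φ ψ σ fzero ∶ Q →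
       applyLayer (writeLayer (σ fzero) g) G₂ ⊩ σ fzero ∶ R) →
    Computes σ R F (applyLayer (writeLayer (σ fzero) g) G₂)
  binaryNode-computes φ ψ {σ} g σ-injective C₁ C₂ gadget = writeLayer-computes g (boolean C₂)
    (gadget (⊩-frame (frame C₂ (leftSlots φ ψ σ fzero) left∉right) (result C₁)) (result C₂))
    (λ i σ∌i a u → trans (frame C₂ i (σ∌i ∘ fsuc ∘ (suc (descendants φ) ↑ʳ_)) a u)
                         (frame C₁ i (σ∌i ∘ fsuc ∘ (_↑ˡ _)) a u))
    where
    left∉right : Avoids (rightSlots φ ψ σ) (leftSlots φ ψ σ fzero)
    left∉right i eq = ↑ˡ≢↑ʳ fzero i (sym (suc-injective (σ-injective eq)))

  compile-sound : ∀ φ σ {F} → Fresh σ → EncodesAtoms F → Computes σ (Sat φ) F (applyLayers (compile φ σ) F)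
  unaryNode-sound : ∀ φ σ op {χ F} → (∀ {G r t} → G ⊩ r ∶ Sat φ → applyLayer (writeLayer t (op r)) G ⊩ t ∶ χ) →
    Fresh σ → EncodesAtoms F → Computes σ χ F (applyLayers (unaryNode φ σ op) F)
  binaryNode-sound : ∀ φ ψ σ op {χ F} →
    (∀ {G r s t} → G ⊩ r ∶ Sat φ → G ⊩ s ∶ Sat ψ → applyLayer (writeLayer t (op r s)) G ⊩ t ∶ χ) →
    Fresh σ → EncodesAtoms F → Computes σ χ F (applyLayers (binaryNode φ ψ σ op) F)

  compile-sound (prop p) σ fr enc =
    writeLayer-computes (copy (atomSlot p)) (bits enc) (copy-⊩ (atoms enc p)) (λ _ _ _ _ → refl)
  compile-sound (¬ₗ φ) σ = unaryNode-sound φ σ negation negation-⊩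
  compile-sound (φ ∧ₗ ψ) σ = binaryNode-sound φ ψ σ conjunction conjunction-⊩
  compile-sound (Xₗ φ) σ = unaryNode-sound φ σ next next-⊩
  compile-sound (φ Uₗ ψ) σ = binaryNode-sound φ ψ σ until until-⊩

  unaryNode-sound φ σ op {χ} {F} gadget fr enc =
    subst (Computes σ χ F) (sym (applyLayers-++ (compile φ (σ ∘ fsuc)) _ F))
      (unaryNode-computes (op (σ (fsuc fzero))) (compile-sound φ (σ ∘ fsuc) (fresh-suc fr) enc) gadget)

  binaryNode-sound φ ψ σ op {χ} {F} gadget fr enc =
    subst (Computes σ χ F) (sym layers) (binaryNode-computes φ ψ g (injective fr) C₁ C₂ gadget)
    where
    σφ : Slots φ
    σφ = leftSlots φ ψ σ
    σψ : Slots ψ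
    σψ = rightSlots φ ψ σ
    g : SlotUpdate d
    g = op (σφ fzero) (σψ fzero)
    C₁ : Computes σφ (Sat φ) F (applyLayers (compile φ σφ) F)
    C₁ = compile-sound φ σφ (fresh-left φ ψ fr) enc
    G₁ : Stream m d
    G₁ = applyLayers (compile φ σφ) F
    C₂ : Computes σψ (Sat ψ) G₁ (applyLayers (compile ψ σψ) G₁)
    C₂ = compile-sound ψ σψ (fresh-right φ ψ fr) (encodesAtoms-frame (fresh-left φ ψ fr) enc C₁)
    layers : applyLayers (binaryNode φ ψ σ op) F ≡
             applyLayer (writeLayer (σ fzero) g) (applyLayers (compile ψ σψ) G₁)
    layers = trans (applyLayers-++ (compile φ σφ) _ F) (applyLayers-++ (compile ψ σψ) _ G₁)

module _ {m : ℕ} (φ : LTL m) where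

  width : ℕ
  width = m ℕ.+ suc (descendants φ)

  atomSlot : Fin m → Fin width
  atomSlot p = p ↑ˡ suc (descendants φ)

  formulaSlots : Fin (suc (descendants φ)) → Fin width
  formulaSlots = m ↑ʳ_

  open Compilation atomSlot

  embed : Letter m → Vector ℚ width
  embed a = (λ p → indicator (p ∈? a)) VF.++ (λ _ → 0ℚ)

  readRoot : Fin 1 → Affine width
  readRoot _ = var (formulaSlots fzero)

  ltlSSM : SSM m
  ltlSSM = record
    { d      = width
    ; emb    = embed
    ; layers = compile φ formulaSlots
    ; out    = single (affineLayer readRoot)
    }

  ltlSSM-diagonal : IsDiag ltlSSM
  ltlSSM-diagonal = compile-diagonal φ formulaSlots

  embedded : Stream m width
  embedded a _ = embed a

  embedded-encodesAtoms : EncodesAtoms embedded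
  embedded-encodesAtoms = record
    { bits  = bits
    ; atoms = λ p → mk⊩ λ a u →
        subst (_encodes _) (sym (lookup-++ˡ _ _ p)) (indicator-encodes (p ∈? a))
    }
    where
    bits : Boolean embedded
    bits a u i with splitAt m i
    ... | inj₁ p = encodes⇒Bit (indicator-encodes (p ∈? a))
    ... | inj₂ _ = inj₁ refl

  formulaSlots-fresh : Fresh formulaSlots
  formulaSlots-fresh = record
    { injective = ↑ʳ-injective m _ _ ; avoids-atoms = λ p k → ↑ˡ≢↑ʳ p k ∘ sym }

  ltlSSM-output : ∀ a (w : Vec (Letter m) k) → runSSM ltlSSM (reverse (a ∷ w)) encodes Sat φ (a ∷ toList w)
  ltlSSM-output a w = subst (_encodes Sat φ (a ∷ toList w)) (sym output) (encoded (result C) a (toList w))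
    where
    C : Computes formulaSlots (Sat φ) embedded (applyLayers (compile φ formulaSlots) embedded)
    C = compile-sound φ formulaSlots formulaSlots-fresh embedded-encodesAtoms
    output : runSSM ltlSSM (reverse (a ∷ w)) ≡
             applyLayers (compile φ formulaSlots) embedded a (toList w) (formulaSlots fzero)
    output = trans (runSSM-reverse ltlSSM a w)
      (trans (evalLayer-affine readRoot _ fzero) (relu-Bit (boolean C a (toList w) (formulaSlots fzero))))

lemma5 : {m : ℕ} (φ : LTL m) →
    Σ (SSM m) λ S → IsDiag S ×
      ((n : ℕ) (w : Vec (Letter m) (suc n)) → (w ⊨ φ) ⇔ Accepts S (reverse w))
lemma5 φ = ltlSSM φ & ltlSSM-diagonal φ & λ where
  n (a ∷ w) → ⇔-trans (⊨⇔Sat φ a w) (encodes⇒⇔ (ltlSSM-output φ a w))
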